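{- Let $\Sigma$ be a finite totally ordered alphabet and let $\prec$ denote $V$-order on $\Sigma^*$. For any two strings $\mathbf{x},\mathbf{y}\in\Sigma^*$ and any letter $\lambda\in\Sigma$, $$\mathbf{x}\prec\mathbf{y}\iff \lambda\mathbf{x}\prec\lambda\mathbf{y}.$$
   Context: $\Sigma^*$ denotes the set of all finite strings over $\Sigma$, including the empty string $\varepsilon$. For a nonempty string $\mathbf{x}=x_1x_2\cdots x_n$, define $h\in\{1,\ldots,n\}$ by $h=1$ if $x_1\le x_2\le\cdots\le x_n$, and otherwise as the unique index with $x_{h-1}>x_h\le x_{h+1}\le\cdots\le x_n$; let $\mathbf{x}^*$ be the string obtained from $\mathbf{x}$ by deleting the letter $x_h$. Write $\mathbf{x}^{s*}$ for the result of applying $^*$ $s$ times ($\mathbf{x}^{0*}=\mathbf{x}$); the sequence $\mathbf{x},\mathbf{x}^*,\mathbf{x}^{2*},\ldots$ ends with $\varepsilon$. $V$-order $\prec$ is defined for distinct strings $\mathbf{x},\mathbf{y}$ as follows: $\mathbf{x}\prec\mathbf{y}$ if $\mathbf{x}$ occurs in the sequence $\mathbf{y},\mathbf{y}^*,\mathbf{y}^{2*},\ldots,\varepsilon$. If neither string occurs in the other's sequence, there are smallest $s,t\ge 0$ with $\mathbf{x}^{(s+1)*}=\mathbf{y}^{(t+1)*}$; put $\mathbf{s}=\mathbf{x}^{s*}$, $\mathbf{t}=\mathbf{y}^{t*}$, which are distinct strings of equal length $m$; let $j\in\{1,\ldots,m\}$ be the largest index with $\mathbf{s}[j]\ne\mathbf{t}[j]$;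 then $\mathbf{x}\prec\mathbf{y}$ iff $\mathbf{s}[j]<\mathbf{t}[j]$ in $\Sigma$. This is a strict total order on $\Sigma^*$. -}

module Defs where

open import Data.Nat using (ℕ; zero; suc; _≤_)
open import Data.Fin using (Fin) renaming (_<_ to _<ᶠ_; _≤?_ to _≤ᶠ?_)
open import Data.List using (List; []; _∷_; _++_; length)
open import Data.Bool using (Bool; true; false; _∧_; if_then_else_)
open import Data.Product using (Σ; _×_; ∃-syntax)
open import Data.Sum using (_⊎_)
open import Relation.Nullary using (¬_; does)
open import Relation.Binary.PropositionalEquality using (_≡_; _≢_)

-- The alphabet Σ is Fin k (any finite total order is isomorphic to one),
-- ordered by the natural order of Fin k.
module _ {k : ℕ} where

  nondecreasing : List (Fin k) → Bool
  nondecreasing []           = true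
  nondecreasing (a ∷ [])     = true
  nondecreasing (a ∷ b ∷ xs) = does (a ≤ᶠ? b) ∧ nondecreasing (b ∷ xs)

  -- x* : delete the letter x_h, where h is the start of the maximal
  -- nondecreasing suffix (h = 1 if the whole string is nondecreasing).
  -- (ε* = ε by convention; never relevant.)
  star : List (Fin k) → List (Fin k)
  star []       = []
  star (a ∷ xs) = if nondecreasing (a ∷ xs) then xs else a ∷ star xs

  starN : ℕ → List (Fin k) → List (Fin k)
  starN zero    x = x
  starN (suc s) x = star (starN s x)

  OccursIn : List (Fin k) → List (Fin k) → Set
  OccursIn x y = ∃[ s ] starN s y ≡ x

  SmallestMeet : List (Fin k) → List (Fin k) → ℕ → ℕ → Set
  SmallestMeet x y s t =
    starN (suc s) x ≡ starN (suc t) y ×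
    (∀ s′ t′ → starN (suc s′) x ≡ starN (suc t′) y → s ≤ s′ × t ≤ t′)

  -- the largest index j with u[j] ≠ v[j] carries letters a (in u) and b (in v):
  -- u = p ++ a ∷ w, v = q ++ b ∷ w, |p| = |q|, a ≠ b (all later positions agree)
  LastDiff : List (Fin k) → List (Fin k) → Fin k → Fin k → Set
  LastDiff u v a b =
    ∃[ p ] ∃[ q ] ∃[ w ]
      (u ≡ p ++ (a ∷ w)) × (v ≡ q ++ (b ∷ w)) × (length p ≡ length q) × (a ≢ b)

  infix 4 _≺_
  _≺_ : List (Fin k) → List (Fin k) → Set
  x ≺ y =
    (x ≢ y × OccursIn x y)
    ⊎ (x ≢ y × ¬ OccursIn x y × ¬ OccursIn y x ×
       ∃[ s ] ∃[ t ] (SmallestMeet x y s t ×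
         ∃[ a ] ∃[ b ] (LastDiff (starN s x) (starN t y) a b × a <ᶠ b)))

-- Prepending c to z leaves the star sequence of z untouched except that c
-- rides in front until c ∷ z^{s*} becomes nondecreasing; then c is deleted
-- and the sequence continues as z^{s*}, z^{(s+1)*}, …  So a witness
-- (s, t, a < b) of x ≺ y becomes a witness of cx ≺ cy, at (s, t) or one
-- step later on both sides.  The one delicate configuration,
-- c deleted on the left but not on the right, cannot occur: the letter that
-- star deletes from a non-nondecreasing word is smaller than its left
-- neighbour, which would force b < a.  Since ≺ is a strict total order,
-- strict monotonicity of c ∷_ also gives the converse.
module Submission where

open import Defs
open import Data.Bool using (Bool; true; false; _∧_; if_then_else_)
open import Data.Bool.Properties using (T-≡)
open import Data.Empty using (⊥-elim)
open import Data.Fin using (Fin; toℕ; _≟_) renaming (_<_ to _<ᶠ_; _≤_ to _≤ᶠ_)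
import Data.Fin.Properties as Fin
open import Data.List using (List; []; _∷_; _++_; length)
open import Data.List.Properties using (∷-injectiveˡ; ∷-injectiveʳ; ≡-dec; length-++)
open import Data.Nat using (ℕ; zero; suc; pred; _+_; _∸_; _≤_; _≤ᵇ_; z≤n)
open import Data.Nat.Properties
  using (≤ᵇ⇒≤; ≤⇒≤ᵇ; ≰⇒>; ≮⇒≥; <⇒≤; ≤-antisym; ≤-total; suc-injective; ∸-cancelˡ-≡;
         m≤n⇒m∸n≡0; m∸n+n≡m; m∸[m∸n]≡n; n∸n≡0; 0∸n≡0; pred[m∸n]≡m∸[1+n]; m+n≡0⇒n≡0)
open import Data.Product using (_×_; _,_; proj₁; proj₂; ∃-syntax)
open import Data.Sum using (_⊎_; inj₁; inj₂; [_,_]′; swap)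
open import Function using (_∘_)
open import Function.Bundles using (_⇔_; mk⇔; Equivalence)
open import Relation.Binary.Definitions using (DecidableEquality; tri<; tri≈; tri>)
open import Relation.Binary.PropositionalEquality
open import Relation.Nullary using (¬_; Dec; yes; no; contradiction)

open ≡-Reasoning

∧-≡-true : ∀ {p q : Bool} → p ∧ q ≡ true → p ≡ true × q ≡ true
∧-≡-true {true} {true} _ = refl , refl

∸-cancelˡ-≢0 : ∀ {m i j} → m ∸ i ≡ m ∸ j → m ∸ i ≢ 0 → i ≡ j
∸-cancelˡ-≢0 {m} eq nz = ∸-cancelˡ-≡ (bound nz) (bound (nz ∘ trans eq)) eq
  where
  bound : ∀ {n} → m ∸ n ≢ 0 → n ≤ m
  bound nz = <⇒≤ (≰⇒> (nz ∘ m≤n⇒m∸n≡0))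

++-cancel-aligned : ∀ {A : Set} (p q : List A) {xs ys : List A} →
                    length p ≡ length q → p ++ xs ≡ q ++ ys → xs ≡ ys
++-cancel-aligned []      []      _   eq = eq
++-cancel-aligned (_ ∷ p) (_ ∷ q) len eq = ++-cancel-aligned p q (suc-injective len) (∷-injectiveʳ eq)
++-cancel-aligned []      (_ ∷ _) ()  _
++-cancel-aligned (_ ∷ _) []      ()  _

bool-cases : ∀ (n : Bool) → n ≡ true ⊎ n ≡ false
bool-cases true  = inj₁ refl
bool-cases false = inj₂ refl

length≡0⇒[] : ∀ {A : Set} {xs : List A} → length xs ≡ 0 → xs ≡ []
length≡0⇒[] {xs = []} _ = refl

last-disagreement : ∀ {A : Set} → DecidableEquality A → (f g : ℕ → A) →
                    ∀ n → f n ≡ g n → f 0 ≢ g 0 → ∃[ s ] (f (suc s) ≡ g (suc s) × f s ≢ g s)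
last-disagreement _≟_ f g zero    agree differ = ⊥-elim (differ agree)
last-disagreement _≟_ f g (suc n) agree differ with f n ≟ g n
... | yes agree′  = last-disagreement _≟_ f g n agree′ differ
... | no  differ′ = n , agree , differ′

module _ {k : ℕ} where

  Word : Set
  Word = List (Fin k)

  _≟ʷ_ : DecidableEquality Word
  _≟ʷ_ = ≡-dec _≟_

  nondecreasing-∷∷ : ∀ {a b : Fin k} {xs : Word} → nondecreasing (a ∷ b ∷ xs) ≡ true →
                     a ≤ᶠ b × nondecreasing (b ∷ xs) ≡ true
  nondecreasing-∷∷ {a} {b} p with ∧-≡-true {toℕ a ≤ᵇ toℕ b} p
  ... | a≤ᵇb , q = ≤ᵇ⇒≤ (toℕ a) (toℕ b) (Equivalence.from T-≡ a≤ᵇb) , q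

  ∷-nondecreasing : ∀ {a b : Fin k} {xs : Word} → a ≤ᶠ b → nondecreasing (b ∷ xs) ≡ true →
                    nondecreasing (a ∷ b ∷ xs) ≡ true
  ∷-nondecreasing a≤b q rewrite Equivalence.to T-≡ (≤⇒≤ᵇ a≤b) = q

  nondecreasing-tail : ∀ {a : Fin k} {xs : Word} → nondecreasing (a ∷ xs) ≡ true → nondecreasing xs ≡ true
  nondecreasing-tail {xs = []}    _ = refl
  nondecreasing-tail {a} {b ∷ xs} p = proj₂ (nondecreasing-∷∷ {a} {b} {xs} p)

  nondecreasing-lower-head : ∀ {c a : Fin k} {xs : Word} → c ≤ᶠ a →
                             nondecreasing (a ∷ xs) ≡ true → nondecreasing (c ∷ xs) ≡ true
  nondecreasing-lower-head {xs = []}    _   _ = refl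
  nondecreasing-lower-head {c} {a} {b ∷ xs} c≤a p with nondecreasing-∷∷ {a} {b} {xs} p
  ... | a≤b , q = ∷-nondecreasing {c} {b} {xs} (Fin.≤-trans c≤a a≤b) q

  head-descent : ∀ {a b : Fin k} {xs : Word} → nondecreasing (a ∷ b ∷ xs) ≡ false →
            nondecreasing (b ∷ xs) ≡ true → b <ᶠ a
  head-descent {a} {b} {xs} f q =
    ≰⇒> λ a≤b → contradiction (trans (sym (∷-nondecreasing {a} {b} {xs} a≤b q)) f) λ ()

  star-nondecreasing : ∀ {a : Fin k} {xs : Word} → nondecreasing (a ∷ xs) ≡ true → star (a ∷ xs) ≡ xs
  star-nondecreasing {a} {xs} p = cong (λ n → if n then xs else a ∷ star xs) p

  star-¬nondecreasing : ∀ {a : Fin k} {xs : Word} → nondecreasing (a ∷ xs) ≡ false →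
                        star (a ∷ xs) ≡ a ∷ star xs
  star-¬nondecreasing {a} {xs} f = cong (λ n → if n then xs else a ∷ star xs) f

  nondecreasing-∷-star : ∀ {c : Fin k} (w : Word) → nondecreasing (c ∷ w) ≡ true →
                         nondecreasing (c ∷ star w) ≡ true
  nondecreasing-∷-star []       _ = refl
  nondecreasing-∷-star {c} (a ∷ xs) p with nondecreasing-∷∷ {c} {a} {xs} p
  ... | c≤a , q = subst (λ w → nondecreasing (c ∷ w) ≡ true) (sym (star-nondecreasing {a} {xs} q))
                        (nondecreasing-lower-head {c} {a} {xs} c≤a q)

  length-star : ∀ (w : Word) → length (star w) ≡ pred (length w)
  length-star []           = refl
  length-star (a ∷ [])     = refl
  length-star (a ∷ b ∷ xs) = length-if (nondecreasing (a ∷ b ∷ xs)) (length-star (b ∷ xs))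
    where
    length-if : ∀ n → length (star (b ∷ xs)) ≡ length xs →
                length (if n then b ∷ xs else a ∷ star (b ∷ xs)) ≡ length (b ∷ xs)
    length-if true  _  = refl
    length-if false ih = cong suc ih

  length-starN : ∀ n (w : Word) → length (starN n w) ≡ length w ∸ n
  length-starN zero    w = refl
  length-starN (suc n) w = begin
    length (star (starN n w))  ≡⟨ length-star (starN n w) ⟩
    pred (length (starN n w))  ≡⟨ cong pred (length-starN n w) ⟩
    pred (length w ∸ n)        ≡⟨ pred[m∸n]≡m∸[1+n] (length w) n ⟩
    length w ∸ suc n           ∎

  length-starN-cong : ∀ n {u v : Word} → length u ≡ length v → length (starN n u) ≡ length (starN n v)
  length-starN-cong n {u} {v} len = begin
    length (starN n u)  ≡⟨ length-starN n u ⟩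
    length u ∸ n        ≡⟨ cong (_∸ n) len ⟩
    length v ∸ n        ≡⟨ length-starN n v ⟨
    length (starN n v)  ∎

  starN-+ : ∀ m n (w : Word) → starN m (starN n w) ≡ starN (m + n) w
  starN-+ zero    n w = refl
  starN-+ (suc m) n w = cong star (starN-+ m n w)

  starN-exhausts : ∀ {n} (w : Word) → length w ≡ n → starN n w ≡ []
  starN-exhausts {n} w refl = length≡0⇒[] (trans (length-starN n w) (n∸n≡0 n))

  starN-index-unique : ∀ (w : Word) {i j} → length (starN i w) ≡ length (starN j w) →
                       length (starN i w) ≢ 0 → i ≡ j
  starN-index-unique w {i} {j} len nz =
    ∸-cancelˡ-≢0 (trans (sym (length-starN i w)) (trans len (length-starN j w)))
                 (nz ∘ trans (length-starN i w))

  module _ {u v : Word} {a b : Fin k} where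

    lastDiff-length : LastDiff u v a b → length u ≡ length v
    lastDiff-length (p , q , w , refl , refl , len , _) = begin
      length (p ++ a ∷ w)          ≡⟨ length-++ p ⟩
      length p + length (a ∷ w)    ≡⟨ cong (_+ suc (length w)) len ⟩
      length q + length (b ∷ w)    ≡⟨ length-++ q ⟨
      length (q ++ b ∷ w)          ∎

    lastDiff-length-≢0 : LastDiff u v a b → length u ≢ 0
    lastDiff-length-≢0 ([]    , _ , _ , refl , _) ()
    lastDiff-length-≢0 (_ ∷ _ , _ , _ , refl , _) ()

    lastDiff⇒≢ : LastDiff u v a b → u ≢ v
    lastDiff⇒≢ (p , q , w , refl , refl , len , a≢b) eq =
      a≢b (∷-injectiveˡ (++-cancel-aligned p q len eq))

    lastDiff-letters-≢ : LastDiff u v a b → a ≢ b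
    lastDiff-letters-≢ (_ , _ , _ , _ , _ , _ , a≢b) = a≢b

    lastDiff-sym : LastDiff u v a b → LastDiff v u b a
    lastDiff-sym (p , q , w , eu , ev , len , a≢b) = q , p , w , ev , eu , sym len , a≢b ∘ sym

    lastDiff-∷ : ∀ c d → LastDiff u v a b → LastDiff (c ∷ u) (d ∷ v) a b
    lastDiff-∷ c d (p , q , w , eu , ev , len , a≢b) =
      c ∷ p , d ∷ q , w , cong (c ∷_) eu , cong (d ∷_) ev , cong suc len , a≢b

  lastDiff-∷⁻ : ∀ {x y : Fin k} {u v : Word} {a b} → LastDiff (x ∷ u) (y ∷ v) a b →
                (u ≡ v × x ≡ a × y ≡ b) ⊎ LastDiff u v a b
  lastDiff-∷⁻ ([]    , []    , _ , refl , refl , _ , _) = inj₁ (refl , refl , refl)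
  lastDiff-∷⁻ (_ ∷ p , _ ∷ q , w , refl , refl , len , a≢b) =
    inj₂ (p , q , w , refl , refl , suc-injective len , a≢b)
  lastDiff-∷⁻ ([]    , _ ∷ _ , _ , _ , _ , () , _)
  lastDiff-∷⁻ (_ ∷ _ , []    , _ , _ , _ , () , _)

  lastDiff-unique : ∀ {u v : Word} {a b a′ b′} → LastDiff u v a b → LastDiff u v a′ b′ → a ≡ a′ × b ≡ b′
  lastDiff-unique {[]}            d _ = ⊥-elim (lastDiff-length-≢0 d refl)
  lastDiff-unique {_ ∷ _} {[]}    d _ = ⊥-elim (lastDiff-length-≢0 (lastDiff-sym d) refl)
  lastDiff-unique {_ ∷ _} {_ ∷ _} d d′ with lastDiff-∷⁻ d | lastDiff-∷⁻ d′
  ... | inj₁ (_ , refl , refl) | inj₁ (_ , refl , refl) = refl , refl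
  ... | inj₁ (u≡v , _)         | inj₂ d′₁               = ⊥-elim (lastDiff⇒≢ d′₁ u≡v)
  ... | inj₂ d₁                | inj₁ (u≡v , _)         = ⊥-elim (lastDiff⇒≢ d₁ u≡v)
  ... | inj₂ d₁                | inj₂ d′₁               = lastDiff-unique d₁ d′₁

  lastDiff-exists : ∀ (u v : Word) → length u ≡ length v → u ≢ v → ∃[ a ] ∃[ b ] LastDiff u v a b
  lastDiff-exists []      []      _   u≢v = ⊥-elim (u≢v refl)
  lastDiff-exists (x ∷ u) (y ∷ v) len u≢v with u ≟ʷ v
  ... | yes refl = x , y , [] , [] , u , refl , refl , refl , u≢v ∘ cong (_∷ u)
  ... | no tails≢ with lastDiff-exists u v (suc-injective len) tails≢
  ...   | a , b , d = a , b , lastDiff-∷ x y d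

  Witness : Word → Word → ℕ → ℕ → Fin k → Fin k → Set
  Witness x y s t a b =
    starN (suc s) x ≡ starN (suc t) y × LastDiff (starN s x) (starN t y) a b × a <ᶠ b

  starN-aligned : ∀ {x y : Word} {i j s t} → starN i x ≡ starN j y → i ≤ s →
                  length (starN s x) ≡ length (starN t y) → length (starN t y) ≢ 0 →
                  starN s x ≡ starN t y
  starN-aligned {x} {y} {i} {j} {s} {t} meet i≤s len nz = trans shifted (cong (λ n → starN n y) index)
    where
    shifted : starN s x ≡ starN (s ∸ i + j) y
    shifted = begin
      starN s x                  ≡⟨ cong (λ n → starN n x) (m∸n+n≡m i≤s) ⟨
      starN (s ∸ i + i) x        ≡⟨ starN-+ (s ∸ i) i x ⟨
      starN (s ∸ i) (starN i x)  ≡⟨ cong (starN (s ∸ i)) meet ⟩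
      starN (s ∸ i) (starN j y)  ≡⟨ starN-+ (s ∸ i) j y ⟩
      starN (s ∸ i + j) y        ∎
    index : s ∸ i + j ≡ t
    index = starN-index-unique y (trans (cong length (sym shifted)) len)
                               (nz ∘ trans (sym len) ∘ trans (cong length shifted))

  -- Two strings that agree at an earlier step than (s, t) would already agree
  -- at (s, t), by length; so a witness is automatically minimal and excludes occurrence.
  witness⇒≺ : ∀ {x y : Word} s t {a b} → Witness x y s t a b → x ≺ y
  witness⇒≺ {x} {y} s t {a} {b} (meet , d , a<b) =
    inj₂ (x≢y , x∉y , y∉x , s , t , (meet , minimal) , a , b , d , a<b)
    where
    len : length (starN s x) ≡ length (starN t y)
    len = lastDiff-length d
    collapseˡ : ∀ {i j} → starN i x ≡ starN j y → ¬ i ≤ s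
    collapseˡ {i} {j} e i≤s =
      lastDiff⇒≢ d (starN-aligned {x} {y} {i} {j} {s} {t} e i≤s len (lastDiff-length-≢0 d ∘ trans len))
    collapseʳ : ∀ {i j} → starN i x ≡ starN j y → ¬ j ≤ t
    collapseʳ {i} {j} e j≤t =
      lastDiff⇒≢ d (sym (starN-aligned {y} {x} {j} {i} {t} {s} (sym e) j≤t (sym len) (lastDiff-length-≢0 d)))
    x≢y : x ≢ y
    x≢y e = collapseˡ {0} {0} e z≤n
    x∉y : ¬ OccursIn x y
    x∉y (i , e) = collapseˡ {0} {i} (sym e) z≤n
    y∉x : ¬ OccursIn y x
    y∉x (i , e) = collapseʳ {i} {0} e z≤n
    minimal : ∀ s′ t′ → starN (suc s′) x ≡ starN (suc t′) y → s ≤ s′ × t ≤ t′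
    minimal s′ t′ e = ≮⇒≥ (collapseˡ {suc s′} {suc t′} e) , ≮⇒≥ (collapseʳ {suc s′} {suc t′} e)

  ≺⇒≢ : ∀ {x y : Word} → x ≺ y → x ≢ y
  ≺⇒≢ (inj₁ (x≢y , _)) = x≢y
  ≺⇒≢ (inj₂ (x≢y , _)) = x≢y

  occurs-antisym : ∀ {x y : Word} → OccursIn x y → OccursIn y x → x ≡ y
  occurs-antisym {y = []}        (i , refl) _        = length≡0⇒[] (trans (length-starN i []) (0∸n≡0 i))
  occurs-antisym {y = y@(_ ∷ _)} (i , refl) (j , e′) = cong (λ n → starN n y) i≡0
    where
    cycle : starN (j + i) y ≡ y
    cycle = trans (sym (starN-+ j i y)) e′
    i≡0 : i ≡ 0
    i≡0 = m+n≡0⇒n≡0 j (starN-index-unique y (cong length cycle) (subst (_≢ 0) (cong length (sym cycle)) λ ()))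

  ≺-asym : ∀ {x y : Word} → x ≺ y → ¬ y ≺ x
  ≺-asym (inj₁ (x≢y , x∈y)) (inj₁ (_ , y∈x)) = x≢y (occurs-antisym x∈y y∈x)
  ≺-asym (inj₁ (_ , x∈y))   (inj₂ (_ , _ , x∉y , _)) = x∉y x∈y
  ≺-asym (inj₂ (_ , _ , y∉x , _)) (inj₁ (_ , y∈x))   = y∉x y∈x
  ≺-asym {x} {y} (inj₂ (_ , _ , _ , s , t , (meet , min) , a , b , d , a<b))
                 (inj₂ (_ , _ , _ , t′ , s′ , (meet′ , min′) , a′ , b′ , d′ , a′<b′))
    with ≤-antisym (proj₁ (min s′ t′ (sym meet′))) (proj₂ (min′ t s (sym meet)))
       | ≤-antisym (proj₂ (min s′ t′ (sym meet′))) (proj₁ (min′ t s (sym meet)))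
  ... | refl | refl with lastDiff-unique d (lastDiff-sym d′)
  ...   | refl , refl = Fin.<-asym a<b a′<b′

  comparable-at : ∀ {x y : Word} {s t} → starN (suc s) x ≡ starN (suc t) y → starN s x ≢ starN t y →
                  length (starN s x) ≡ length (starN t y) → x ≺ y ⊎ y ≺ x
  comparable-at {x} {y} {s} {t} meet differ len with lastDiff-exists (starN s x) (starN t y) len differ
  ... | a , b , d with Fin.<-cmp a b
  ...   | tri< a<b _ _ = inj₁ (witness⇒≺ s t (meet , d , a<b))
  ...   | tri≈ _ a≡b _ = ⊥-elim (lastDiff-letters-≢ d a≡b)
  ...   | tri> _ _ b<a = inj₂ (witness⇒≺ t s (sym meet , lastDiff-sym d , b<a))

  ≺-total-≤ : ∀ {x y : Word} → length x ≤ length y → x ≢ y → x ≺ y ⊎ y ≺ x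
  ≺-total-≤ {x} {y} |x|≤|y| x≢y =
    compare-with (length y ∸ length x) (trans (length-starN (length y ∸ length x) y) (m∸[m∸n]≡n |x|≤|y|))
    where
    compare-with : ∀ δ → length (starN δ y) ≡ length x → x ≺ y ⊎ y ≺ x
    compare-with δ len with x ≟ʷ starN δ y
    ... | yes x≡y′ = inj₁ (inj₁ (x≢y , δ , sym x≡y′))
    ... | no  x≢y′
      with last-disagreement _≟ʷ_ (λ i → starN i x) (λ i → starN i (starN δ y)) (length x)
             (trans (starN-exhausts x refl) (sym (starN-exhausts (starN δ y) len))) x≢y′
    ...   | s , meet , differ =
      comparable-at {x} {y} {s} {s + δ} (trans meet (starN-+ (suc s) δ y))
                    (differ ∘ λ e → trans e (sym (starN-+ s δ y)))
                    (trans (length-starN-cong s {x} {starN δ y} (sym len)) (cong length (starN-+ s δ y)))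

  ≺-total : ∀ {x y : Word} → x ≢ y → x ≺ y ⊎ y ≺ x
  ≺-total {x} {y} x≢y with ≤-total (length x) (length y)
  ... | inj₁ |x|≤|y| = ≺-total-≤ |x|≤|y| x≢y
  ... | inj₂ |y|≤|x| = swap (≺-total-≤ |y|≤|x| (x≢y ∘ sym))

  starN-∷-kept : ∀ (c : Fin k) (z : Word) s → nondecreasing (c ∷ starN s z) ≡ false →
                 starN s (c ∷ z) ≡ c ∷ starN s z
  starN-∷-kept c z zero    _ = refl
  starN-∷-kept c z (suc s) f with bool-cases (nondecreasing (c ∷ starN s z))
  ... | inj₁ e = contradiction (trans (sym (nondecreasing-∷-star (starN s z) e)) f) λ ()
  ... | inj₂ e = trans (cong star (starN-∷-kept c z s e)) (star-¬nondecreasing {c} {starN s z} e)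

  starN-∷-kept-suc : ∀ (c : Fin k) (z : Word) s → nondecreasing (c ∷ starN s z) ≡ false →
                     starN (suc s) (c ∷ z) ≡ c ∷ starN (suc s) z
  starN-∷-kept-suc c z s f = trans (cong star (starN-∷-kept c z s f)) (star-¬nondecreasing {c} {starN s z} f)

  starN-∷-dropped : ∀ (c : Fin k) (z : Word) s → nondecreasing (c ∷ starN s z) ≡ true →
                    starN (suc s) (c ∷ z) ≡ starN s z
  starN-∷-dropped c z zero    p = star-nondecreasing {c} {z} p
  starN-∷-dropped c z (suc s) p with bool-cases (nondecreasing (c ∷ starN s z))
  ... | inj₁ e = cong star (starN-∷-dropped c z s e)
  ... | inj₂ e = trans (cong star (starN-∷-kept-suc c z s e)) (star-nondecreasing {c} {starN (suc s) z} p)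

  -- In a nondecreasing c ∷ w, star deletes the first letter of w; if that
  -- leaves c ∷ m, the deleted letter was squeezed between c and c.
  nondecreasing-star-≡-∷ : ∀ {c : Fin k} {m : Word} (w : Word) → nondecreasing (c ∷ w) ≡ true →
                           star w ≡ c ∷ m → w ≡ c ∷ c ∷ m
  nondecreasing-star-≡-∷ []       _ ()
  nondecreasing-star-≡-∷ {c} {m} (g ∷ w) p e = cong₂ _∷_ g≡c w≡cm
    where
    w≡cm : w ≡ c ∷ m
    w≡cm = trans (sym (star-nondecreasing {g} {w} (nondecreasing-tail {c} {g ∷ w} p))) e
    g≡c : g ≡ c
    g≡c = Fin.≤-antisym
      (proj₁ (nondecreasing-∷∷ {g} {c} {m} (subst (λ v → nondecreasing (g ∷ v) ≡ true) w≡cm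
                                                   (nondecreasing-tail {c} {g ∷ w} p))))
      (proj₁ (nondecreasing-∷∷ {c} {g} {w} p))

  starN-∷-repeated : ∀ (c : Fin k) (z : Word) {m} t → starN t z ≡ c ∷ m → starN t (c ∷ z) ≡ c ∷ starN t z
  starN-∷-repeated c z zero    _ = refl
  starN-∷-repeated c z {m} (suc t) e with bool-cases (nondecreasing (c ∷ starN t z))
  ... | inj₂ nd = starN-∷-kept-suc c z t nd
  ... | inj₁ nd = begin
    starN (suc t) (c ∷ z)  ≡⟨ starN-∷-dropped c z t nd ⟩
    starN t z              ≡⟨ nondecreasing-star-≡-∷ (starN t z) nd e ⟩
    c ∷ c ∷ m              ≡⟨ cong (c ∷_) e ⟨
    c ∷ starN (suc t) z    ∎

  -- star deletes the letter x_h with x_{h-1} > x_h after which v is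
  -- nondecreasing; shifting star v one place right puts x_{h-1} in its place.
  lastDiff-∷-star : ∀ (h : Fin k) (v : Word) → nondecreasing v ≡ false →
                    ∃[ a ] ∃[ b ] (LastDiff (h ∷ star v) v a b × b <ᶠ a)
  lastDiff-∷-star h []             ()
  lastDiff-∷-star h (_ ∷ [])       ()
  lastDiff-∷-star h (v₀ ∷ w₀ ∷ ws) f =
    [ sorted-tail , extend ∘ lastDiff-∷-star v₀ (w₀ ∷ ws) ]′ (bool-cases (nondecreasing (w₀ ∷ ws)))
    where
    Goal : Set
    Goal = ∃[ a ] ∃[ b ] (LastDiff (h ∷ star (v₀ ∷ w₀ ∷ ws)) (v₀ ∷ w₀ ∷ ws) a b × b <ᶠ a)
    sorted-tail : nondecreasing (w₀ ∷ ws) ≡ true → Goal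
    sorted-tail e = v₀ , w₀ , (h ∷ [] , v₀ ∷ [] , ws , cong (h ∷_) star≡ , refl , refl , w₀≢v₀ ∘ sym) , w₀<v₀
      where
      star≡ : star (v₀ ∷ w₀ ∷ ws) ≡ v₀ ∷ ws
      star≡ = trans (star-¬nondecreasing {v₀} {w₀ ∷ ws} f) (cong (v₀ ∷_) (star-nondecreasing {w₀} {ws} e))
      w₀<v₀ : w₀ <ᶠ v₀
      w₀<v₀ = head-descent {v₀} {w₀} {ws} f e
      w₀≢v₀ : w₀ ≢ v₀
      w₀≢v₀ = Fin.<⇒≢ w₀<v₀
    extend : ∃[ a ] ∃[ b ] (LastDiff (v₀ ∷ star (w₀ ∷ ws)) (w₀ ∷ ws) a b × b <ᶠ a) → Goal
    extend (a , b , d , b<a) =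
      a , b , subst (λ u → LastDiff (h ∷ u) (v₀ ∷ w₀ ∷ ws) a b) (sym (star-¬nondecreasing {v₀} {w₀ ∷ ws} f))
                    (lastDiff-∷ h v₀ d) , b<a

  lastDiff-∷-star-descends : ∀ {h : Fin k} {v : Word} {a b} → nondecreasing v ≡ false →
                             LastDiff (h ∷ star v) v a b → b <ᶠ a
  lastDiff-∷-star-descends {h} {v} f d with lastDiff-∷-star h v f
  ... | a′ , b′ , d′ , b′<a′ with lastDiff-unique d d′
  ...   | refl , refl = b′<a′

  ∷-nondecreasing-transfer : ∀ (c : Fin k) {u v : Word} {a b} → nondecreasing (c ∷ u) ≡ true →
                             star u ≡ star v → LastDiff u v a b → a <ᶠ b → nondecreasing (c ∷ v) ≡ true
  ∷-nondecreasing-transfer c {[]}            _ _ d _ = ⊥-elim (lastDiff-length-≢0 d refl)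
  ∷-nondecreasing-transfer c {_ ∷ _} {[]}    _ _ d _ = ⊥-elim (lastDiff-length-≢0 (lastDiff-sym d) refl)
  ∷-nondecreasing-transfer c {h ∷ m} {b₀ ∷ m′} {a} {b} p stars d a<b with bool-cases (nondecreasing (b₀ ∷ m′))
  ... | inj₁ e = ∷-nondecreasing {c} {b₀} {m′} (Fin.≤-trans c≤h (<⇒≤ h<b₀)) e
    where
    c≤h : c ≤ᶠ h
    c≤h = proj₁ (nondecreasing-∷∷ {c} {h} {m} p)
    m≡m′ : m ≡ m′
    m≡m′ = trans (sym (star-nondecreasing {h} {m} (nondecreasing-tail {c} {h ∷ m} p)))
                 (trans stars (star-nondecreasing {b₀} {m′} e))
    h<b₀ : h <ᶠ b₀
    h<b₀ with lastDiff-unique d ([] , [] , m , refl , cong (b₀ ∷_) (sym m≡m′) , refl ,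
                                 λ h≡b₀ → lastDiff⇒≢ d (cong₂ _∷_ h≡b₀ m≡m′))
    ... | refl , refl = a<b
  ... | inj₂ e = ⊥-elim (Fin.<-asym a<b (lastDiff-∷-star-descends e d′))
    where
    m≡ : m ≡ star (b₀ ∷ m′)
    m≡ = trans (sym (star-nondecreasing {h} {m} (nondecreasing-tail {c} {h ∷ m} p))) stars
    d′ : LastDiff (h ∷ star (b₀ ∷ m′)) (b₀ ∷ m′) a b
    d′ = subst (λ w → LastDiff (h ∷ w) (b₀ ∷ m′) a b) m≡ d

  ≺-by-head : ∀ {x y : Word} {c d : Fin k} {m : Word} s t → c ≢ d →
              starN s x ≡ c ∷ m → starN t y ≡ d ∷ m → nondecreasing (c ∷ d ∷ m) ≡ true → x ≺ y
  ≺-by-head {x} {y} {c} {d} {m} s t c≢d reachedˣ reachedʸ p =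
    witness⇒≺ s t (meet , ([] , [] , m , reachedˣ , reachedʸ , refl , c≢d) , Fin.≤∧≢⇒< c≤d c≢d)
    where
    c≤d : c ≤ᶠ d
    c≤d = proj₁ (nondecreasing-∷∷ {c} {d} {m} p)
    d∷m↑ : nondecreasing (d ∷ m) ≡ true
    d∷m↑ = nondecreasing-tail {c} {d ∷ m} p
    meet : starN (suc s) x ≡ starN (suc t) y
    meet = begin
      star (starN s x)  ≡⟨ cong star reachedˣ ⟩
      star (c ∷ m)      ≡⟨ star-nondecreasing {c} {m} (nondecreasing-lower-head {c} {d} {m} c≤d d∷m↑) ⟩
      m                 ≡⟨ star-nondecreasing {d} {m} d∷m↑ ⟨
      star (d ∷ m)      ≡⟨ cong star reachedʸ ⟨
      star (starN t y)  ∎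

  ∷-≺-reaching : ∀ (c d : Fin k) {x y : Word} t → x ≢ y → starN t (c ∷ y) ≡ d ∷ x →
                 nondecreasing (c ∷ d ∷ x) ≡ true → (c ∷ x) ≺ (c ∷ y)
  ∷-≺-reaching c d t x≢y reached p with c ≟ d
  ... | yes refl = inj₁ (x≢y ∘ ∷-injectiveʳ , t , reached)
  ... | no c≢d   = ≺-by-head 0 t c≢d refl reached p

  ∷-mono-occurs : ∀ (c : Fin k) {x y : Word} → x ≢ y → OccursIn x y → (c ∷ x) ≺ (c ∷ y)
  ∷-mono-occurs c {x} {y} x≢y (i , e)
    with last-disagreement _≟ʷ_ (λ j → starN j y) (λ _ → x) i e (x≢y ∘ sym)
  ... | j , reached , before with bool-cases (nondecreasing (c ∷ starN j y))
  ...   | inj₂ kept    = inj₁ (x≢y ∘ ∷-injectiveʳ , suc j ,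
                               trans (starN-∷-kept-suc c y j kept) (cong (c ∷_) reached))
  ...   | inj₁ dropped = dropped-at (starN j y) (starN-∷-dropped c y j dropped) dropped reached before
    where
    dropped-at : ∀ w → starN (suc j) (c ∷ y) ≡ w → nondecreasing (c ∷ w) ≡ true → star w ≡ x → w ≢ x →
                 (c ∷ x) ≺ (c ∷ y)
    dropped-at []      _       _ []≡x []≢x = ⊥-elim ([]≢x []≡x)
    dropped-at (d ∷ w) reached′ p st  _    =
      ∷-≺-reaching c d (suc j) x≢y (trans reached′ (cong (d ∷_) w≡x))
                   (subst (λ u → nondecreasing (c ∷ d ∷ u) ≡ true) w≡x p)
      where
      w≡x : w ≡ x
      w≡x = trans (sym (star-nondecreasing {d} {w} (nondecreasing-tail {c} {d ∷ w} p))) st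

  ∷-mono-kept-dropped : ∀ (c : Fin k) {x y : Word} s t {a b} → Witness x y s t a b →
                        nondecreasing (c ∷ starN s x) ≡ false → nondecreasing (c ∷ starN t y) ≡ true →
                        (c ∷ x) ≺ (c ∷ y)
  ∷-mono-kept-dropped c {x} {y} s t {a} {b} (meet , d , a<b) keptˣ droppedʸ = at (starN t y) refl
    where
    at : ∀ v → starN t y ≡ v → (c ∷ x) ≺ (c ∷ y)
    at []      v≡ = ⊥-elim (lastDiff-length-≢0 (lastDiff-sym d) (cong length v≡))
    at (h ∷ m) v≡ = by-letter (c ≟ h)
      where
      p : nondecreasing (c ∷ h ∷ m) ≡ true
      p = subst (λ u → nondecreasing (c ∷ u) ≡ true) v≡ droppedʸ
      reachedʸ : starN (suc t) (c ∷ y) ≡ h ∷ m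
      reachedʸ = trans (starN-∷-dropped c y t droppedʸ) v≡
      reachedˣ : starN (suc s) (c ∷ x) ≡ c ∷ m
      reachedˣ = begin
        starN (suc s) (c ∷ x)  ≡⟨ starN-∷-kept-suc c x s keptˣ ⟩
        c ∷ starN (suc s) x    ≡⟨ cong (c ∷_) meet ⟩
        c ∷ starN (suc t) y    ≡⟨ cong ((c ∷_) ∘ star) v≡ ⟩
        c ∷ star (h ∷ m)       ≡⟨ cong (c ∷_) (star-nondecreasing {h} {m} (nondecreasing-tail {c} {h ∷ m} p)) ⟩
        c ∷ m                  ∎
      by-letter : Dec (c ≡ h) → (c ∷ x) ≺ (c ∷ y)
      by-letter (no c≢h)   = ≺-by-head (suc s) (suc t) c≢h reachedˣ reachedʸ p
      by-letter (yes c≡h) = witness⇒≺ s t (trans reachedˣ (sym (trans reachedʸ h∷m≡)) , d′ , a<b)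
        where
        h∷m≡ : h ∷ m ≡ c ∷ m
        h∷m≡ = cong (_∷ m) (sym c≡h)
        d′ : LastDiff (starN s (c ∷ x)) (starN t (c ∷ y)) a b
        d′ = subst₂ (λ u w → LastDiff u w a b) (sym (starN-∷-kept c x s keptˣ))
                    (sym (starN-∷-repeated c y t (trans v≡ h∷m≡))) (lastDiff-∷ c c d)

  ∷-mono-witness : ∀ (c : Fin k) {x y : Word} s t {a b} → Witness x y s t a b → (c ∷ x) ≺ (c ∷ y)
  ∷-mono-witness c {x} {y} s t {a} {b} w@(meet , d , a<b)
    with bool-cases (nondecreasing (c ∷ starN s x)) | bool-cases (nondecreasing (c ∷ starN t y))
  ... | inj₂ keptˣ    | inj₂ keptʸ    = witness⇒≺ s t (meet′ , d′ , a<b)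
    where
    meet′ : starN (suc s) (c ∷ x) ≡ starN (suc t) (c ∷ y)
    meet′ = begin
      starN (suc s) (c ∷ x)  ≡⟨ starN-∷-kept-suc c x s keptˣ ⟩
      c ∷ starN (suc s) x    ≡⟨ cong (c ∷_) meet ⟩
      c ∷ starN (suc t) y    ≡⟨ starN-∷-kept-suc c y t keptʸ ⟨
      starN (suc t) (c ∷ y)  ∎
    d′ : LastDiff (starN s (c ∷ x)) (starN t (c ∷ y)) a b
    d′ = subst₂ (λ u v → LastDiff u v a b) (sym (starN-∷-kept c x s keptˣ)) (sym (starN-∷-kept c y t keptʸ))
                (lastDiff-∷ c c d)
  ... | inj₁ droppedˣ | inj₁ droppedʸ = witness⇒≺ (suc s) (suc t) (meet′ , d′ , a<b)
    where
    meet′ : starN (suc (suc s)) (c ∷ x) ≡ starN (suc (suc t)) (c ∷ y)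
    meet′ = begin
      star (starN (suc s) (c ∷ x))  ≡⟨ cong star (starN-∷-dropped c x s droppedˣ) ⟩
      starN (suc s) x               ≡⟨ meet ⟩
      starN (suc t) y               ≡⟨ cong star (starN-∷-dropped c y t droppedʸ) ⟨
      star (starN (suc t) (c ∷ y))  ∎
    d′ : LastDiff (starN (suc s) (c ∷ x)) (starN (suc t) (c ∷ y)) a b
    d′ = subst₂ (λ u v → LastDiff u v a b) (sym (starN-∷-dropped c x s droppedˣ))
                (sym (starN-∷-dropped c y t droppedʸ)) d
  ... | inj₁ droppedˣ | inj₂ keptʸ    =
    contradiction (trans (sym (∷-nondecreasing-transfer c droppedˣ meet d a<b)) keptʸ) λ ()
  ... | inj₂ keptˣ    | inj₁ droppedʸ = ∷-mono-kept-dropped c s t w keptˣ droppedʸ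

  ∷-mono-≺ : ∀ (c : Fin k) {x y : Word} → x ≺ y → (c ∷ x) ≺ (c ∷ y)
  ∷-mono-≺ c (inj₁ (x≢y , x∈y)) = ∷-mono-occurs c x≢y x∈y
  ∷-mono-≺ c (inj₂ (_ , _ , _ , s , t , (meet , _) , _ , _ , d , a<b)) = ∷-mono-witness c s t (meet , d , a<b)

  ∷-cancel-≺ : ∀ (c : Fin k) {x y : Word} → (c ∷ x) ≺ (c ∷ y) → x ≺ y
  ∷-cancel-≺ c cx≺cy with ≺-total (≺⇒≢ cx≺cy ∘ cong (c ∷_))
  ... | inj₁ x≺y = x≺y
  ... | inj₂ y≺x = ⊥-elim (≺-asym cx≺cy (∷-mono-≺ c y≺x))

lemma4 : (k : ℕ) (x y : List (Fin k)) (c : Fin k) →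
    (x ≺ y) ⇔ ((c ∷ x) ≺ (c ∷ y))
lemma4 k x y c = mk⇔ (∷-mono-≺ c) (∷-cancel-≺ c)
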